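{- Let $n,r$ be non-negative integers, $p$ a prime number and $m\in\{0,1,\dots,p-1\}$. Then $$\sum_{k=m}^{p-1}(-x)^k\frac{\mathcal{F}_n(x;r+k,k)}{(k-m)!}\equiv (-1)^m m!\,(r+m)^n\,\mathcal{P}_{p-1}(x;m)\pmod{p\mathbb{Z}_p[x]}.$$ In particular, for $m=0$, $$\sum_{k=0}^{p-1}(-x)^k\frac{\mathcal{F}_n(x;r+k,k)}{k!}\equiv r^n\sum_{i=0}^{p-1}(-x)^i\pmod{p\mathbb{Z}_p[x]}.$$
   Context: ${n\brace k}_r$ denotes the $r$-Stirling numbers of the second kind: the number of partitions of $\{1,\dots,n\}$ into $k$ nonempty blocks such that $1,\dots,r$ lie in distinct blocks. The $(r,s)$-Fubini polynomials are $\mathcal{F}_n(x;r,s)=\sum_{k=0}^n {n+r\brace k+r}_r (k+s)!\,x^k$. The polynomials $\mathcal{P}_n$ are $\mathcal{P}_n(x;r)=\sum_{j=0}^n(-1)^j\binom{j+r}{r}x^{n-j}$. Convention $0^0=1$. $\mathbb{Z}_p$ is the ring of $p$-adic integers, and $A\equiv B\pmod{p\mathbb{Z}_p[x]}$ means corresponding coefficients are congruent modulo $p$ (the factorials in denominators are invertible mod $p$ since $k<p$). -}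

module Defs where

open import Data.Nat as ℕ using (ℕ; zero; suc; _∸_; _!; _≤?_; _≟_; _<_)
open import Data.Nat.Properties using (_!≢0)
open import Data.Nat.Combinatorics using (_C_)
open import Data.Integer as ℤ using (ℤ; +_)
open import Data.Rational as ℚ using (ℚ; 0ℚ; 1ℚ; _+_; _*_; _-_; -_; _/_; ↧ₙ_)
open import Data.List using (List; map; foldr; upTo)
open import Data.Bool using (Bool; true; false; if_then_else_; _∧_)
open import Relation.Nullary.Decidable using (⌊_⌋; yes; no)
open import Relation.Nullary using (¬_)
open import Relation.Binary.PropositionalEquality using (_≡_)
open import Data.Product using (Σ; _×_)

-- r-Stirling numbers of the second kind  rS r n k = {n brace k}_r,
-- defined by the standard (Broder) recurrence:
--   {n brace k}_r = 0                      if n < r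
--   {r brace k}_r = δ_{k,r}
--   {n brace k}_r = k {n-1 brace k}_r + {n-1 brace k-1}_r   if n > r
-- (the k-1 term is absent when k = 0).

rS : ℕ → ℕ → ℕ → ℕ
rS r zero k = if ⌊ r ≟ 0 ⌋ ∧ ⌊ k ≟ 0 ⌋ then 1 else 0
rS r (suc n) k with suc n ≤? r
... | yes _ = if ⌊ suc n ≟ r ⌋ ∧ ⌊ k ≟ r ⌋ then 1 else 0
... | no _ = step k
  where
  step : ℕ → ℕ
  step zero    = 0
  step (suc j) = suc j ℕ.* rS r n (suc j) ℕ.+ rS r n j

-- Polynomials in x with rational coefficients, as coefficient functions
-- (coefficient of x^i at index i).  All polynomials used below have
-- finite support by construction.

Poly : Set
Poly = ℕ → ℚ

ℕtoℚ : ℕ → ℚ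
ℕtoℚ n = (+ n) / 1

sgn : ℕ → ℚ
sgn zero    = 1ℚ
sgn (suc j) = - sgn j

invFact : ℕ → ℚ
invFact k = (+ 1) / (k !)
  where instance _ = k !≢0

scale : ℚ → Poly → Poly
scale c f i = c * f i

shiftX : ℕ → Poly → Poly
shiftX k f i = if ⌊ k ≤? i ⌋ then f (i ∸ k) else 0ℚ

sumFromTo : ℕ → ℕ → (ℕ → Poly) → Poly
sumFromTo a b F i = foldr _+_ 0ℚ (map (λ t → F (a ℕ.+ t) i) (upTo (b ∸ a)))

-- (r,s)-Fubini polynomial
--   F_n(x;r,s) = Σ_{k=0}^n {n+r brace k+r}_r (k+s)! x^k
fubini : ℕ → ℕ → ℕ → Poly
fubini n r s k =
  if ⌊ k ≤? n ⌋ then ℕtoℚ (rS r (n ℕ.+ r) (k ℕ.+ r) ℕ.* (k ℕ.+ s) !) else 0ℚ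

-- P_n(x;r) = Σ_{j=0}^n (-1)^j C(j+r, r) x^{n-j};
-- coefficient of x^i (i ≤ n) has j = n - i.
polyP : ℕ → ℕ → Poly
polyP n r i =
  if ⌊ i ≤? n ⌋ then sgn (n ∸ i) * ℕtoℚ ((n ∸ i ℕ.+ r) C r) else 0ℚ

altGeom : ℕ → Poly
altGeom N i = if ⌊ suc i ≤? N ⌋ then sgn i else 0ℚ

-- ℚ ∩ ℤ_p: rationals whose reduced denominator is prime to p.
InZp : ℕ → ℚ → Set
InZp p c = ¬ (p ℕD.∣ ↧ₙ c)
  where import Data.Nat.Divisibility as ℕD

CongQ : ℕ → ℚ → ℚ → Set
CongQ p a b = Σ ℚ λ c → InZp p c × (a - b ≡ ℕtoℚ p * c)

CongPoly : ℕ → Poly → Poly → Set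
CongPoly p A B = ∀ i → CongQ p (A i) (B i)

{-# OPTIONS --safe #-}
module Submission where

-- Compare coefficients of x^i. On the left the coefficient is (-1)^m i! A, where, with R = r + m,
-- A = Σ_{t < p-m} (-1)^t / t! {n+R+t brace i+r}_{R+t}. The recurrence of the r-Stirling numbers
-- evaluates A exactly: A = 0 for i < m, and for i = m + a with a < p - m, induction on n gives
-- A = (-1)^a R^n / a!. So for m ≤ i < p the coefficient is (-1)^i R^n (a+1)⋯(a+m). Put j = p-1-i:
-- since a + m + 1 + j = p, each factor a + k is ≡ -(j + m + 1 - k), whence
-- (a+1)⋯(a+m) ≡ (-1)^m (j+1)⋯(j+m) = (-1)^m m! C(j+m, m), and (-1)^i ≡ (-1)^j because i + j = p - 1.
-- For i ≥ p the factor i! is divisible by p, and for i < m so is C(j+m, m) on the right.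

open import Defs
open import Data.Empty using (⊥-elim)
open import Data.Integer.Base as ℤ using (+_)
import Data.Integer.GCD as ℤ
import Data.Integer.Properties as ℤ
open import Data.List.Base using (map; foldr; applyUpTo)
open import Data.Nat.Base as ℕ using (ℕ; zero; suc; _+_; _∸_; _^_; _!; _<_; _≤_; z≤n; s≤s)
open import Data.Nat.Combinatorics using (_C_; nCk≡n!/k![n-k]!; k![n∸k]!∣n!)
open import Data.Nat.DivMod using (m/n*n≡m)
open import Data.Nat.Divisibility as ℕ using (_∣_; divides)
import Data.Nat.GCD as ℕ
open import Data.Nat.Primality using (Prime; euclidsLemma; prime⇒irreducible; prime⇒nonZero; ¬prime[1])
open import Data.Nat.Properties using (_≟_; _≤?_)
import Data.Nat.Properties as ℕ
import Data.Nat.Tactic.RingSolver as ℕ-Solver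
open import Data.Product.Base using (Σ; ∃; _×_; _,_)
open import Data.Rational.Base as ℚ using (ℚ; 0ℚ; 1ℚ; _*_; -_; _-_; _/_; ↧ₙ_; ↥_; ↧_; toℚᵘ)
import Data.Rational.Properties as ℚ
open import Data.Rational.Solver using (module +-*-Solver)
import Data.Rational.Unnormalised.Base as ℚᵘ
import Data.Rational.Unnormalised.Properties as ℚᵘ
open import Data.Sum.Base using (_⊎_; inj₁; inj₂)
open import Function.Base using (_∘_; id)
open import Level using (0ℓ)
open import Relation.Binary.Bundles using (Setoid)
open import Relation.Binary.Definitions using (tri<; tri≈; tri>)
open import Relation.Binary.PropositionalEquality
open import Relation.Nullary.Decidable using (yes; no; isYes≗does; dec-true)
open import Relation.Nullary.Negation using (¬_)

open import Algebra.Properties.CommutativeSemigroup ℕ.+-commutativeSemigroup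
  using (x∙yz≈xz∙y; xy∙z≈x∙zy; xy∙z≈zx∙y)
open +-*-Solver

-- Finite sums

∑ : ℕ → (ℕ → ℚ) → ℚ
∑ zero    f = 0ℚ
∑ (suc N) f = f 0 ℚ.+ ∑ N (f ∘ suc)

foldr-map-applyUpTo : ∀ N (g : ℕ → ℕ) (f : ℕ → ℚ) →
                      foldr ℚ._+_ 0ℚ (map f (applyUpTo g N)) ≡ ∑ N (f ∘ g)
foldr-map-applyUpTo zero    g f = refl
foldr-map-applyUpTo (suc N) g f = cong (f (g 0) ℚ.+_) (foldr-map-applyUpTo N (g ∘ suc) f)

sumFromTo≡∑ : ∀ a b (F : ℕ → Poly) i → sumFromTo a b F i ≡ ∑ (b ∸ a) (λ t → F (a + t) i)
sumFromTo≡∑ a b F i = foldr-map-applyUpTo (b ∸ a) id (λ t → F (a + t) i)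

∑-cong : ∀ N {f g : ℕ → ℚ} → (∀ {t} → t < N → f t ≡ g t) → ∑ N f ≡ ∑ N g
∑-cong zero    f≡g = refl
∑-cong (suc N) f≡g = cong₂ ℚ._+_ (f≡g (s≤s z≤n)) (∑-cong N (λ t<N → f≡g (s≤s t<N)))

∑-zero : ∀ N {f : ℕ → ℚ} → (∀ {t} → t < N → f t ≡ 0ℚ) → ∑ N f ≡ 0ℚ
∑-zero zero    f≡0 = refl
∑-zero (suc N) f≡0 = cong₂ ℚ._+_ (f≡0 (s≤s z≤n)) (∑-zero N (λ t<N → f≡0 (s≤s t<N)))

∑-single : ∀ N a {f : ℕ → ℚ} → a < N →
           (∀ {t} → t < N → t ≢ a → f t ≡ 0ℚ) → ∑ N f ≡ f a
∑-single (suc N) zero    {f} a<N f≡0 = begin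
  f 0 ℚ.+ ∑ N (f ∘ suc) ≡⟨ cong (f 0 ℚ.+_) (∑-zero N (λ t<N → f≡0 (s≤s t<N) λ ())) ⟩
  f 0 ℚ.+ 0ℚ            ≡⟨ ℚ.+-identityʳ (f 0) ⟩
  f 0                   ∎
  where open ≡-Reasoning
∑-single (suc N) (suc a) {f} (s≤s a<N) f≡0 = begin
  f 0 ℚ.+ ∑ N (f ∘ suc)
    ≡⟨ cong₂ ℚ._+_ (f≡0 (s≤s z≤n) λ ())
                   (∑-single N a a<N λ t<N t≢a → f≡0 (s≤s t<N) (t≢a ∘ ℕ.suc-injective)) ⟩
  0ℚ ℚ.+ f (suc a)
    ≡⟨ ℚ.+-identityˡ (f (suc a)) ⟩
  f (suc a) ∎
  where open ≡-Reasoning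

∑-distrib-+ : ∀ N (f g : ℕ → ℚ) → ∑ N (λ t → f t ℚ.+ g t) ≡ ∑ N f ℚ.+ ∑ N g
∑-distrib-+ zero    f g = refl
∑-distrib-+ (suc N) f g = begin
  f 0 ℚ.+ g 0 ℚ.+ ∑ N (λ t → f (suc t) ℚ.+ g (suc t))
    ≡⟨ cong (f 0 ℚ.+ g 0 ℚ.+_) (∑-distrib-+ N (f ∘ suc) (g ∘ suc)) ⟩
  f 0 ℚ.+ g 0 ℚ.+ (∑ N (f ∘ suc) ℚ.+ ∑ N (g ∘ suc))
    ≡⟨ solve 4 (λ a b c d → a :+ b :+ (c :+ d) := a :+ c :+ (b :+ d)) refl (f 0) (g 0) _ _ ⟩
  f 0 ℚ.+ ∑ N (f ∘ suc) ℚ.+ (g 0 ℚ.+ ∑ N (g ∘ suc)) ∎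
  where open ≡-Reasoning

*-distribˡ-∑ : ∀ N c (f : ℕ → ℚ) → c * ∑ N f ≡ ∑ N (λ t → c * f t)
*-distribˡ-∑ zero    c f = ℚ.*-zeroʳ c
*-distribˡ-∑ (suc N) c f =
  trans (ℚ.*-distribˡ-+ c (f 0) _) (cong (c * f 0 ℚ.+_) (*-distribˡ-∑ N c (f ∘ suc)))

-- Rational arithmetic

ℕtoℚᵘ : ℕ → ℚᵘ.ℚᵘ
ℕtoℚᵘ n = ℚᵘ.mkℚᵘ (+ n) 0

toℚᵘ-ℕtoℚ : ∀ n → toℚᵘ (ℕtoℚ n) ℚᵘ.≃ ℕtoℚᵘ n
toℚᵘ-ℕtoℚ n = ℚ.toℚᵘ-fromℚᵘ (ℕtoℚᵘ n)

ℕtoℚ-+ : ∀ a b → ℕtoℚ (a + b) ≡ ℕtoℚ a ℚ.+ ℕtoℚ b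
ℕtoℚ-+ a b = ℚ.toℚᵘ-injective (begin
  toℚᵘ (ℕtoℚ (a + b))              ≈⟨ toℚᵘ-ℕtoℚ (a + b) ⟩
  ℕtoℚᵘ (a + b)                    ≈⟨ ℚᵘ.*≡* (cong (ℤ._* + 1) +[a+b]≡+a*1++b*1) ⟩
  ℕtoℚᵘ a ℚᵘ.+ ℕtoℚᵘ b             ≈⟨ ℚᵘ.+-cong (toℚᵘ-ℕtoℚ a) (toℚᵘ-ℕtoℚ b) ⟨
  toℚᵘ (ℕtoℚ a) ℚᵘ.+ toℚᵘ (ℕtoℚ b) ≈⟨ ℚ.toℚᵘ-homo-+ (ℕtoℚ a) (ℕtoℚ b) ⟨
  toℚᵘ (ℕtoℚ a ℚ.+ ℕtoℚ b)         ∎)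
  where
  open ℚᵘ.≃-Reasoning
  +[a+b]≡+a*1++b*1 : + (a + b) ≡ + a ℤ.* + 1 ℤ.+ + b ℤ.* + 1
  +[a+b]≡+a*1++b*1 =
    trans (ℤ.pos-+ a b) (sym (cong₂ ℤ._+_ (ℤ.*-identityʳ (+ a)) (ℤ.*-identityʳ (+ b))))

ℕtoℚ-* : ∀ a b → ℕtoℚ (a ℕ.* b) ≡ ℕtoℚ a * ℕtoℚ b
ℕtoℚ-* a b = ℚ.toℚᵘ-injective (begin
  toℚᵘ (ℕtoℚ (a ℕ.* b))            ≈⟨ toℚᵘ-ℕtoℚ (a ℕ.* b) ⟩
  ℕtoℚᵘ (a ℕ.* b)                  ≈⟨ ℚᵘ.*≡* (cong (ℤ._* + 1) (ℤ.pos-* a b)) ⟩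
  ℕtoℚᵘ a ℚᵘ.* ℕtoℚᵘ b             ≈⟨ ℚᵘ.*-cong (toℚᵘ-ℕtoℚ a) (toℚᵘ-ℕtoℚ b) ⟨
  toℚᵘ (ℕtoℚ a) ℚᵘ.* toℚᵘ (ℕtoℚ b) ≈⟨ ℚ.toℚᵘ-homo-* (ℕtoℚ a) (ℕtoℚ b) ⟨
  toℚᵘ (ℕtoℚ a * ℕtoℚ b)           ∎)
  where open ℚᵘ.≃-Reasoning

ℕtoℚ[d]*[1/d]≡1 : ∀ d .{{_ : ℕ.NonZero d}} → ℕtoℚ d * ((+ 1) / d) ≡ 1ℚ
ℕtoℚ[d]*[1/d]≡1 d@(suc d-1) = ℚ.toℚᵘ-injective (begin
  toℚᵘ (ℕtoℚ d * ((+ 1) / d))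
    ≈⟨ ℚ.toℚᵘ-homo-* (ℕtoℚ d) ((+ 1) / d) ⟩
  toℚᵘ (ℕtoℚ d) ℚᵘ.* toℚᵘ ((+ 1) / d)
    ≈⟨ ℚᵘ.*-cong (toℚᵘ-ℕtoℚ d) (ℚ.toℚᵘ-fromℚᵘ (ℚᵘ.mkℚᵘ (+ 1) d-1)) ⟩
  ℕtoℚᵘ d ℚᵘ.* ℚᵘ.1/ ℕtoℚᵘ d
    ≈⟨ ℚᵘ.*-inverseʳ (ℕtoℚᵘ d) ⟩
  ℚᵘ.1ℚᵘ ∎)
  where open ℚᵘ.≃-Reasoning

ℕtoℚ[k!]*invFact[k]≡1 : ∀ k → ℕtoℚ (k !) * invFact k ≡ 1ℚ
ℕtoℚ[k!]*invFact[k]≡1 k = ℕtoℚ[d]*[1/d]≡1 (k !) {{k ℕ.!≢0}}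

invFact-suc : ∀ k → invFact k ≡ ℕtoℚ (suc k) * invFact (suc k)
invFact-suc k = begin
  I                      ≡⟨ ℚ.*-identityʳ I ⟨
  I * 1ℚ                 ≡⟨ cong (I *_) (ℕtoℚ[k!]*invFact[k]≡1 (suc k)) ⟨
  I * (ℕtoℚ (S ℕ.* k !) * I′) ≡⟨ cong (λ x → I * (x * I′)) (ℕtoℚ-* S (k !)) ⟩
  I * (ℕtoℚ S * F * I′)  ≡⟨ solve 4 (λ I I′ S F → I :* (S :* F :* I′) := F :* I :* (S :* I′))
                                    refl I I′ (ℕtoℚ S) F ⟩
  F * I * (ℕtoℚ S * I′)  ≡⟨ cong (_* (ℕtoℚ S * I′)) (ℕtoℚ[k!]*invFact[k]≡1 k) ⟩
  1ℚ * (ℕtoℚ S * I′)     ≡⟨ ℚ.*-identityˡ _ ⟩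
  ℕtoℚ S * I′            ∎
  where
  open ≡-Reasoning
  S = suc k
  I = invFact k
  I′ = invFact (suc k)
  F = ℕtoℚ (k !)

sgn-+ : ∀ i j → sgn (i + j) ≡ sgn i * sgn j
sgn-+ zero    j = sym (ℚ.*-identityˡ (sgn j))
sgn-+ (suc i) j = trans (cong -_ (sgn-+ i j)) (ℚ.neg-distribˡ-* (sgn i) (sgn j))

sgn[k]*sgn[k]≡1 : ∀ k → sgn k * sgn k ≡ 1ℚ
sgn[k]*sgn[k]≡1 zero    = refl
sgn[k]*sgn[k]≡1 (suc k) =
  trans (solve 1 (λ s → (:- s) :* (:- s) := s :* s) refl (sgn k)) (sgn[k]*sgn[k]≡1 k)

sgn-even-sum : ∀ i j k → i + j ≡ k + k → sgn i ≡ sgn j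
sgn-even-sum i j k i+j≡k+k = begin
  sgn i                       ≡⟨ ℚ.*-identityʳ (sgn i) ⟨
  sgn i * 1ℚ                  ≡⟨ cong (sgn i *_) (sgn[k]*sgn[k]≡1 j) ⟨
  sgn i * (sgn j * sgn j)     ≡⟨ ℚ.*-assoc (sgn i) (sgn j) (sgn j) ⟨
  sgn i * sgn j * sgn j       ≡⟨ cong (_* sgn j) (sgn-+ i j) ⟨
  sgn (i + j) * sgn j         ≡⟨ cong (λ n → sgn n * sgn j) i+j≡k+k ⟩
  sgn (k + k) * sgn j         ≡⟨ cong (_* sgn j) (trans (sgn-+ k k) (sgn[k]*sgn[k]≡1 k)) ⟩
  1ℚ * sgn j                  ≡⟨ ℚ.*-identityˡ (sgn j) ⟩
  sgn j                       ∎
  where open ≡-Reasoning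

even⊎odd : ∀ n → (∃ λ k → n ≡ k + k) ⊎ (∃ λ k → n ≡ suc (k + k))
even⊎odd zero    = inj₁ (0 , refl)
even⊎odd (suc n) with even⊎odd n
... | inj₁ (k , n≡k+k)   = inj₂ (k , cong suc n≡k+k)
... | inj₂ (k , n≡1+k+k) = inj₁ (suc k , cong suc (trans n≡1+k+k (sym (ℕ.+-suc k k))))

-- r-Stirling numbers

K<R⇒rS≡0 : ∀ R N K → K < R → rS R N K ≡ 0
K<R⇒rS≡0 (suc R) zero    K       K<R = refl
K<R⇒rS≡0 R       (suc N) K       K<R with suc N ≤? R
... | yes _ with suc N ≟ R | K ≟ R
...   | _     | yes K≡R = ⊥-elim (ℕ.<-irrefl K≡R K<R)
...   | yes _ | no  _   = refl
...   | no  _ | no  _   = refl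
K<R⇒rS≡0 R (suc N) zero    K<R | no _ = refl
K<R⇒rS≡0 R (suc N) (suc K) K<R | no _
  rewrite K<R⇒rS≡0 R N (suc K) K<R | K<R⇒rS≡0 R N K (ℕ.<-trans (ℕ.n<1+n K) K<R) =
  trans (ℕ.+-identityʳ (suc K ℕ.* 0)) (ℕ.*-zeroʳ (suc K))

N<K⇒rS≡0 : ∀ R N K → N < K → rS R N K ≡ 0
N<K⇒rS≡0 R zero    (suc K) N<K with R ≟ 0
... | yes _ = refl
... | no  _ = refl
N<K⇒rS≡0 R (suc N) K       N<K with suc N ≤? R
... | yes _ with suc N ≟ R | K ≟ R
...   | yes refl | yes refl = ⊥-elim (ℕ.<-irrefl refl N<K)
...   | yes _    | no  _    = refl
...   | no  _    | _        = refl
N<K⇒rS≡0 R (suc N) (suc K) N<K | no _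
  rewrite N<K⇒rS≡0 R N (suc K) (ℕ.<-trans (ℕ.n<1+n N) N<K) | N<K⇒rS≡0 R N K (ℕ.≤-pred N<K) =
  trans (ℕ.+-identityʳ (suc K ℕ.* 0)) (ℕ.*-zeroʳ (suc K))

K≢R⇒rS[R,R,K]≡0 : ∀ R K → K ≢ R → rS R R K ≡ 0
K≢R⇒rS[R,R,K]≡0 R K K≢R with ℕ.<-cmp K R
... | tri< K<R _   _   = K<R⇒rS≡0 R R K K<R
... | tri≈ _   K≡R _   = ⊥-elim (K≢R K≡R)
... | tri> _   _   R<K = N<K⇒rS≡0 R R K R<K

rS-diag : ∀ R → rS R R R ≡ 1
rS-diag zero    = refl
rS-diag (suc R) with suc R ≤? suc R
... | yes _   rewrite trans (isYes≗does (suc R ≟ suc R)) (dec-true (suc R ≟ suc R) refl) = refl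
... | no  R≰R = ⊥-elim (R≰R ℕ.≤-refl)

rS-suc-suc : ∀ R N K → R ≤ N → rS R (suc N) (suc K) ≡ suc K ℕ.* rS R N (suc K) + rS R N K
rS-suc-suc R N K R≤N with suc N ≤? R
... | yes N<R = ⊥-elim (ℕ.<-irrefl refl (ℕ.<-≤-trans N<R R≤N))
... | no  _   = refl

rS-suc-zero : ∀ R N → R ≤ N → rS R (suc N) 0 ≡ 0
rS-suc-zero R N R≤N with suc N ≤? R
... | yes N<R = ⊥-elim (ℕ.<-irrefl refl (ℕ.<-≤-trans N<R R≤N))
... | no  _   = refl

stirlingTerm : ℕ → ℕ → ℕ → ℕ → ℚ
stirlingTerm R n K t = sgn t * invFact t * ℕtoℚ (rS (R + t) (n + (R + t)) K)

stirlingTerm-zero : ∀ R n K t → rS (R + t) (n + (R + t)) K ≡ 0 → stirlingTerm R n K t ≡ 0ℚ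
stirlingTerm-zero R n K t rS≡0 =
  trans (cong (λ x → sgn t * invFact t * ℕtoℚ x) rS≡0) (ℚ.*-zeroʳ (sgn t * invFact t))

stirlingTerm-suc-suc : ∀ R n K t → stirlingTerm R (suc n) (suc K) t
                       ≡ ℕtoℚ (suc K) * stirlingTerm R n (suc K) t ℚ.+ stirlingTerm R n K t
stirlingTerm-suc-suc R n K t = begin
  s * ℕtoℚ (rS (R + t) (suc (n + (R + t))) (suc K))
    ≡⟨ cong (λ x → s * ℕtoℚ x) (rS-suc-suc (R + t) (n + (R + t)) K (ℕ.m≤n+m (R + t) n)) ⟩
  s * ℕtoℚ (suc K ℕ.* S₁ + S₀)
    ≡⟨ cong (s *_) (trans (ℕtoℚ-+ (suc K ℕ.* S₁) S₀)
                          (cong (ℚ._+ ℕtoℚ S₀) (ℕtoℚ-* (suc K) S₁))) ⟩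
  s * (ℕtoℚ (suc K) * ℕtoℚ S₁ ℚ.+ ℕtoℚ S₀)
    ≡⟨ solve 4 (λ s k x y → s :* (k :* x :+ y) := k :* (s :* x) :+ s :* y)
               refl s (ℕtoℚ (suc K)) (ℕtoℚ S₁) (ℕtoℚ S₀) ⟩
  ℕtoℚ (suc K) * (s * ℕtoℚ S₁) ℚ.+ s * ℕtoℚ S₀ ∎
  where
  open ≡-Reasoning
  s = sgn t * invFact t
  S₁ = rS (R + t) (n + (R + t)) (suc K)
  S₀ = rS (R + t) (n + (R + t)) K

module _ (N : ℕ) where

  altStirling : ℕ → ℕ → ℕ → ℚ
  altStirling R n K = ∑ N (stirlingTerm R n K)

  altStirling-< : ∀ R n K → K < R → altStirling R n K ≡ 0ℚ
  altStirling-< R n K K<R = ∑-zero N λ {t} _ →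
    stirlingTerm-zero R n K t (K<R⇒rS≡0 (R + t) (n + (R + t)) K (ℕ.<-≤-trans K<R (ℕ.m≤m+n R t)))

  altStirling-suc-zero : ∀ R n → altStirling R (suc n) 0 ≡ 0ℚ
  altStirling-suc-zero R n = ∑-zero N λ {t} _ →
    stirlingTerm-zero R (suc n) 0 t (rS-suc-zero (R + t) (n + (R + t)) (ℕ.m≤n+m (R + t) n))

  altStirling-suc-suc : ∀ R n K →
    altStirling R (suc n) (suc K) ≡ ℕtoℚ (suc K) * altStirling R n (suc K) ℚ.+ altStirling R n K
  altStirling-suc-suc R n K = begin
    ∑ N (stirlingTerm R (suc n) (suc K))
      ≡⟨ ∑-cong N (λ {t} _ → stirlingTerm-suc-suc R n K t) ⟩
    ∑ N (λ t → ℕtoℚ (suc K) * stirlingTerm R n (suc K) t ℚ.+ stirlingTerm R n K t)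
      ≡⟨ ∑-distrib-+ N _ _ ⟩
    ∑ N (λ t → ℕtoℚ (suc K) * stirlingTerm R n (suc K) t) ℚ.+ altStirling R n K
      ≡⟨ cong (ℚ._+ altStirling R n K) (*-distribˡ-∑ N (ℕtoℚ (suc K)) _) ⟨
    ℕtoℚ (suc K) * altStirling R n (suc K) ℚ.+ altStirling R n K ∎
    where open ≡-Reasoning

  altStirling-value : ∀ R n a → a < N → altStirling R n (R + a) ≡ sgn a * ℕtoℚ (R ^ n) * invFact a
  altStirling-value R zero a a<N = begin
    ∑ N (stirlingTerm R 0 (R + a))
      ≡⟨ ∑-single N a a<N (λ {t} _ t≢a → stirlingTerm-zero R 0 (R + a) t
           (K≢R⇒rS[R,R,K]≡0 (R + t) (R + a) (t≢a ∘ sym ∘ ℕ.+-cancelˡ-≡ R a t))) ⟩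
    sgn a * invFact a * ℕtoℚ (rS (R + a) (R + a) (R + a))
      ≡⟨ cong (λ x → sgn a * invFact a * ℕtoℚ x) (rS-diag (R + a)) ⟩
    sgn a * invFact a * 1ℚ
      ≡⟨ solve 2 (λ s i → s :* i :* con 1ℚ := s :* con 1ℚ :* i) refl (sgn a) (invFact a) ⟩
    sgn a * 1ℚ * invFact a ∎
    where open ≡-Reasoning
  altStirling-value zero (suc n) zero a<N = altStirling-suc-zero 0 n
  altStirling-value (suc R) (suc n) zero a<N = begin
    altStirling (suc R) (suc n) (suc (R + 0))
      ≡⟨ altStirling-suc-suc (suc R) n (R + 0) ⟩
    ℕtoℚ (suc (R + 0)) * altStirling (suc R) n (suc R + 0) ℚ.+ altStirling (suc R) n (R + 0)
      ≡⟨ cong₂ (λ x y → ℕtoℚ (suc R + 0) * x ℚ.+ y) (altStirling-value (suc R) n 0 a<N)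
               (altStirling-< (suc R) n (R + 0) (ℕ.s≤s (ℕ.≤-reflexive (ℕ.+-identityʳ R)))) ⟩
    ℕtoℚ (suc R + 0) * (1ℚ * X * 1ℚ) ℚ.+ 0ℚ
      ≡⟨ cong (λ k → ℕtoℚ k * (1ℚ * X * 1ℚ) ℚ.+ 0ℚ) (ℕ.+-identityʳ (suc R)) ⟩
    ℕtoℚ (suc R) * (1ℚ * X * 1ℚ) ℚ.+ 0ℚ
      ≡⟨ solve 2 (λ k x → k :* (con 1ℚ :* x :* con 1ℚ) :+ con 0ℚ := con 1ℚ :* (k :* x) :* con 1ℚ)
                 refl (ℕtoℚ (suc R)) X ⟩
    1ℚ * (ℕtoℚ (suc R) * X) * 1ℚ
      ≡⟨ cong (λ x → 1ℚ * x * 1ℚ) (ℕtoℚ-* (suc R) (suc R ^ n)) ⟨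
    1ℚ * ℕtoℚ (suc R ^ suc n) * 1ℚ ∎
    where
    open ≡-Reasoning
    X = ℕtoℚ (suc R ^ n)
  altStirling-value R (suc n) (suc a) a<N = begin
    altStirling R (suc n) (R + suc a)
      ≡⟨ cong (altStirling R (suc n)) (ℕ.+-suc R a) ⟩
    altStirling R (suc n) (suc (R + a))
      ≡⟨ altStirling-suc-suc R n (R + a) ⟩
    ℕtoℚ (suc (R + a)) * altStirling R n (suc (R + a)) ℚ.+ altStirling R n (R + a)
      ≡⟨ cong (λ K → ℕtoℚ K * altStirling R n K ℚ.+ altStirling R n (R + a)) (ℕ.+-suc R a) ⟨
    ℕtoℚ (R + suc a) * altStirling R n (R + suc a) ℚ.+ altStirling R n (R + a)
      ≡⟨ cong₂ (λ x y → ℕtoℚ (R + suc a) * x ℚ.+ y) (altStirling-value R n (suc a) a<N)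
                                                      (altStirling-value R n a (ℕ.<-trans (ℕ.n<1+n a) a<N)) ⟩
    ℕtoℚ (R + suc a) * (- s * X * I′) ℚ.+ s * X * invFact a
      ≡⟨ cong₂ (λ k i → k * (- s * X * I′) ℚ.+ s * X * i) (ℕtoℚ-+ R (suc a)) (invFact-suc a) ⟩
    (ℕtoℚ R ℚ.+ A) * (- s * X * I′) ℚ.+ s * X * (A * I′)
      ≡⟨ solve 5 (λ r a s x i → (r :+ a) :* (:- s :* x :* i) :+ s :* x :* (a :* i)
                                  := :- s :* (r :* x) :* i)
                 refl (ℕtoℚ R) A s X I′ ⟩
    - s * (ℕtoℚ R * X) * I′
      ≡⟨ cong (λ x → - s * x * I′) (ℕtoℚ-* R (R ^ n)) ⟨
    sgn (suc a) * ℕtoℚ (R ^ suc n) * invFact (suc a) ∎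
    where
    open ≡-Reasoning
    s = sgn a
    X = ℕtoℚ (R ^ n)
    A = ℕtoℚ (suc a)
    I′ = invFact (suc a)

-- Coefficients of the left-hand side

coeff-shiftX-fubini : ∀ n r k i →
  shiftX k (fubini n (r + k) k) i ≡ ℕtoℚ (rS (r + k) (n + (r + k)) (i + r) ℕ.* i !)
coeff-shiftX-fubini n r k i with k ≤? i
... | no k≰i =
  cong (λ x → ℕtoℚ (x ℕ.* i !)) (sym (K<R⇒rS≡0 (r + k) (n + (r + k)) (i + r) i+r<r+k))
  where
  i+r<r+k : i + r < r + k
  i+r<r+k = subst (_< r + k) (ℕ.+-comm r i) (ℕ.+-monoʳ-< r (ℕ.≰⇒> k≰i))
... | yes k≤i with i ∸ k ≤? n
...   | yes _ =
  cong₂ (λ K j → ℕtoℚ (rS (r + k) (n + (r + k)) K ℕ.* j !)) i∸k+[r+k]≡i+r i∸k+k≡i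
  where
  i∸k+k≡i : i ∸ k + k ≡ i
  i∸k+k≡i = ℕ.m∸n+n≡m k≤i
  i∸k+[r+k]≡i+r : i ∸ k + (r + k) ≡ i + r
  i∸k+[r+k]≡i+r = trans (x∙yz≈xz∙y (i ∸ k) r k) (cong (_+ r) i∸k+k≡i)
...   | no i∸k≰n =
  cong (λ x → ℕtoℚ (x ℕ.* i !)) (sym (N<K⇒rS≡0 (r + k) (n + (r + k)) (i + r) n+[r+k]<i+r))
  where
  n+[r+k]<i+r : n + (r + k) < i + r
  n+[r+k]<i+r = subst₂ _<_ (xy∙z≈x∙zy n k r) (cong (_+ r) (ℕ.m∸n+n≡m k≤i))
                  (ℕ.+-monoˡ-< r (ℕ.+-monoˡ-< k (ℕ.≰⇒> i∸k≰n)))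

coeff-fubiniSum : ∀ n r m p i →
  sumFromTo m p (λ k → scale (sgn k * invFact (k ∸ m)) (shiftX k (fubini n (r + k) k))) i
    ≡ sgn m * ℕtoℚ (i !) * altStirling (p ∸ m) (r + m) n (i + r)
coeff-fubiniSum n r m p i = begin
  sumFromTo m p F i
    ≡⟨ sumFromTo≡∑ m p F i ⟩
  ∑ (p ∸ m) (λ t → F (m + t) i)
    ≡⟨ ∑-cong (p ∸ m) (λ {t} _ → summand t) ⟩
  ∑ (p ∸ m) (λ t → sgn m * ℕtoℚ (i !) * stirlingTerm (r + m) n (i + r) t)
    ≡⟨ *-distribˡ-∑ (p ∸ m) (sgn m * ℕtoℚ (i !)) _ ⟨
  sgn m * ℕtoℚ (i !) * altStirling (p ∸ m) (r + m) n (i + r) ∎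
  where
  open ≡-Reasoning
  F : ℕ → Poly
  F k = scale (sgn k * invFact (k ∸ m)) (shiftX k (fubini n (r + k) k))
  summand : ∀ t → F (m + t) i ≡ sgn m * ℕtoℚ (i !) * stirlingTerm (r + m) n (i + r) t
  summand t = begin
    sgn (m + t) * invFact (m + t ∸ m) * shiftX (m + t) (fubini n (r + (m + t)) (m + t)) i
      ≡⟨ cong₂ (λ s j → s * invFact j * shiftX (m + t) (fubini n (r + (m + t)) (m + t)) i)
               (sgn-+ m t) (ℕ.m+n∸m≡n m t) ⟩
    sgn m * sgn t * invFact t * shiftX (m + t) (fubini n (r + (m + t)) (m + t)) i
      ≡⟨ cong (sgn m * sgn t * invFact t *_) (coeff-shiftX-fubini n r (m + t) i) ⟩
    sgn m * sgn t * invFact t * ℕtoℚ (rS (r + (m + t)) (n + (r + (m + t))) (i + r) ℕ.* i !)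
      ≡⟨ cong (λ R → sgn m * sgn t * invFact t * ℕtoℚ (rS R (n + R) (i + r) ℕ.* i !))
              (sym (ℕ.+-assoc r m t)) ⟩
    sgn m * sgn t * invFact t * ℕtoℚ (S ℕ.* i !)
      ≡⟨ cong (sgn m * sgn t * invFact t *_) (ℕtoℚ-* S (i !)) ⟩
    sgn m * sgn t * invFact t * (ℕtoℚ S * ℕtoℚ (i !))
      ≡⟨ solve 5 (λ a b c d e → a :* b :* c :* (d :* e) := a :* e :* (b :* c :* d))
               refl (sgn m) (sgn t) (invFact t) (ℕtoℚ S) (ℕtoℚ (i !)) ⟩
    sgn m * ℕtoℚ (i !) * stirlingTerm (r + m) n (i + r) t ∎
    where S = rS (r + m + t) (n + (r + m + t)) (i + r)

rising : ℕ → ℕ → ℕ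
rising a zero    = 1
rising a (suc m) = rising a m ℕ.* (a + suc m)

[m+a]!≡a!*rising : ∀ m a → (m + a) ! ≡ a ! ℕ.* rising a m
[m+a]!≡a!*rising zero    a = sym (ℕ.*-identityʳ (a !))
[m+a]!≡a!*rising (suc m) a =
  trans (cong (suc (m + a) ℕ.*_) ([m+a]!≡a!*rising m a)) (rearrange m a (a !) (rising a m))
  where
  rearrange : ∀ m a x y → suc (m + a) ℕ.* (x ℕ.* y) ≡ x ℕ.* (y ℕ.* (a + suc m))
  rearrange = ℕ-Solver.solve-∀

rising-suc : ∀ a m → rising a (suc m) ≡ suc a ℕ.* rising (suc a) m
rising-suc a zero    =
  trans (ℕ.*-identityˡ (a + 1)) (trans (ℕ.+-comm a 1) (sym (ℕ.*-identityʳ (suc a))))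
rising-suc a (suc m) =
  trans (cong (ℕ._* (a + suc (suc m))) (rising-suc a m)) (rearrange a (rising (suc a) m) m)
  where
  rearrange : ∀ a x m → suc a ℕ.* x ℕ.* (a + suc (suc m)) ≡ suc a ℕ.* (x ℕ.* (suc a + suc m))
  rearrange = ℕ-Solver.solve-∀

nCk*[k!*[n∸k]!]≡n! : ∀ {n k} → k ≤ n → (n C k) ℕ.* (k ! ℕ.* (n ∸ k) !) ≡ n !
nCk*[k!*[n∸k]!]≡n! {n} {k} k≤n =
  trans (cong (ℕ._* (k ! ℕ.* (n ∸ k) !)) (nCk≡n!/k![n-k]! k≤n))
        (m/n*n≡m {{k ℕ.!* (n ∸ k) !≢0}} (k![n∸k]!∣n! k≤n))

m!*[j+m]Cm≡rising : ∀ j m → m ! ℕ.* ((j + m) C m) ≡ rising j m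
m!*[j+m]Cm≡rising j m = ℕ.*-cancelʳ-≡ _ _ (j !) {{j ℕ.!≢0}} (begin
  m ! ℕ.* B ℕ.* j !                 ≡⟨ rearrange (m !) B (j !) ⟩
  B ℕ.* (m ! ℕ.* j !)               ≡⟨ cong (λ x → B ℕ.* (m ! ℕ.* x !)) (ℕ.m+n∸n≡m j m) ⟨
  B ℕ.* (m ! ℕ.* (j + m ∸ m) !)     ≡⟨ nCk*[k!*[n∸k]!]≡n! (ℕ.m≤n+m m j) ⟩
  (j + m) !                         ≡⟨ cong _! (ℕ.+-comm j m) ⟩
  (m + j) !                         ≡⟨ [m+a]!≡a!*rising m j ⟩
  j ! ℕ.* rising j m                ≡⟨ ℕ.*-comm (j !) (rising j m) ⟩
  rising j m ℕ.* j !                ∎)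
  where
  open ≡-Reasoning
  B = (j + m) C m
  rearrange : ∀ x y z → x ℕ.* y ℕ.* z ≡ y ℕ.* (x ℕ.* z)
  rearrange = ℕ-Solver.solve-∀

scaled-altStirling-value : ∀ N n r m a → a < N →
  sgn m * ℕtoℚ ((m + a) !) * altStirling N (r + m) n (m + a + r)
    ≡ sgn (m + a) * (ℕtoℚ ((r + m) ^ n) * ℕtoℚ (rising a m))
scaled-altStirling-value N n r m a a<N = begin
  sgn m * ℕtoℚ ((m + a) !) * altStirling N (r + m) n (m + a + r)
    ≡⟨ cong (sgn m * ℕtoℚ ((m + a) !) *_) (cong (altStirling N (r + m) n) (xy∙z≈zx∙y m a r)) ⟩
  sgn m * ℕtoℚ ((m + a) !) * altStirling N (r + m) n (r + m + a)
    ≡⟨ cong₂ (λ F A → sgn m * F * A)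
             (trans (cong ℕtoℚ ([m+a]!≡a!*rising m a)) (ℕtoℚ-* (a !) (rising a m)))
             (altStirling-value N (r + m) n a a<N) ⟩
  sgn m * (ℕtoℚ (a !) * Rₐ) * (sgn a * X * invFact a)
    ≡⟨ solve 6 (λ s F R t X I → s :* (F :* R) :* (t :* X :* I) := F :* I :* (s :* t :* (X :* R)))
             refl (sgn m) (ℕtoℚ (a !)) Rₐ (sgn a) X (invFact a) ⟩
  ℕtoℚ (a !) * invFact a * (sgn m * sgn a * (X * Rₐ))
    ≡⟨ cong₂ (λ u s → u * (s * (X * Rₐ))) (ℕtoℚ[k!]*invFact[k]≡1 a) (sym (sgn-+ m a)) ⟩
  1ℚ * (sgn (m + a) * (X * Rₐ))
    ≡⟨ ℚ.*-identityˡ _ ⟩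
  sgn (m + a) * (X * Rₐ) ∎
  where
  open ≡-Reasoning
  X = ℕtoℚ ((r + m) ^ n)
  Rₐ = ℕtoℚ (rising a m)

-- Reduction modulo p

↧ₙ[i/n]∣n : ∀ i n .{{_ : ℕ.NonZero n}} → ↧ₙ (i / n) ∣ n
↧ₙ[i/n]∣n i n = divides (ℕ.gcd ℤ.∣ i ∣ n) (begin
  n                                 ≡⟨ cong ℤ.∣_∣ (ℚ.↧-/ i n) ⟨
  ℤ.∣ ↧ (i / n) ℤ.* ℤ.gcd i (+ n) ∣ ≡⟨ ℤ.abs-* (↧ (i / n)) (ℤ.gcd i (+ n)) ⟩
  ↧ₙ (i / n) ℕ.* ℕ.gcd ℤ.∣ i ∣ n    ≡⟨ ℕ.*-comm (↧ₙ (i / n)) _ ⟩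
  ℕ.gcd ℤ.∣ i ∣ n ℕ.* ↧ₙ (i / n)    ∎)
  where open ≡-Reasoning

↧ₙ[a+b]∣↧ₙa*↧ₙb : ∀ a b → ↧ₙ (a ℚ.+ b) ∣ ↧ₙ a ℕ.* ↧ₙ b
↧ₙ[a+b]∣↧ₙa*↧ₙb a@record{} b@record{} =
  ↧ₙ[i/n]∣n (↥ a ℤ.* ↧ b ℤ.+ ↥ b ℤ.* ↧ a) (↧ₙ a ℕ.* ↧ₙ b)

↧ₙ[a*b]∣↧ₙa*↧ₙb : ∀ a b → ↧ₙ (a * b) ∣ ↧ₙ a ℕ.* ↧ₙ b
↧ₙ[a*b]∣↧ₙa*↧ₙb a@record{} b@record{} =
  ↧ₙ[i/n]∣n (↥ a ℤ.* ↥ b) (↧ₙ a ℕ.* ↧ₙ b)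

module ModuloPrime {p : ℕ} (p-prime : Prime p) where

  private instance
    p≢0 : ℕ.NonZero p
    p≢0 = prime⇒nonZero p-prime

  1+[p∸1]≡p : suc (p ∸ 1) ≡ p
  1+[p∸1]≡p = ℕ.suc-pred p

  p∤1 : ¬ p ∣ 1
  p∤1 p∣1 = ¬prime[1] (subst Prime (ℕ.∣1⇒≡1 p∣1) p-prime)

  p∤k! : ∀ {k} → k < p → ¬ p ∣ k !
  p∤k! {zero}  _   = p∤1
  p∤k! {suc k} k<p p∣k! with euclidsLemma (suc k) (k !) p-prime p∣k!
  ... | inj₁ p∣1+k = ℕ.<⇒≱ k<p (ℕ.∣⇒≤ p∣1+k)
  ... | inj₂ p∣k!  = p∤k! (ℕ.<-trans (ℕ.n<1+n k) k<p) p∣k!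

  p∣n! : ∀ {n} → p ≤ n → p ∣ n !
  p∣n! p≤n =
    ℕ.∣-trans (subst (λ q → q ∣ q !) 1+[p∸1]≡p (ℕ.m∣m*n ((p ∸ 1) !))) (ℕ.m≤n⇒m!∣n! p≤n)

  p∣nCk : ∀ {n k} → k < p → p ≤ n → n ∸ k < p → p ∣ n C k
  p∣nCk {n} {k} k<p p≤n n∸k<p
    with euclidsLemma (n C k) (k ! ℕ.* (n ∸ k) !) p-prime
           (subst (p ∣_) (sym (nCk*[k!*[n∸k]!]≡n! (ℕ.<⇒≤ (ℕ.<-≤-trans k<p p≤n)))) (p∣n! p≤n))
  ... | inj₁ p∣nCk = p∣nCk
  ... | inj₂ p∣k!*[n∸k]! with euclidsLemma (k !) ((n ∸ k) !) p-prime p∣k!*[n∸k]!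
  ...   | inj₁ p∣k!     = ⊥-elim (p∤k! k<p p∣k!)
  ...   | inj₂ p∣[n∸k]! = ⊥-elim (p∤k! n∸k<p p∣[n∸k]!)

  InZp-+ : ∀ a b → InZp p a → InZp p b → InZp p (a ℚ.+ b)
  InZp-+ a b a∈ℤp b∈ℤp p∣↧
    with euclidsLemma (↧ₙ a) (↧ₙ b) p-prime (ℕ.∣-trans p∣↧ (↧ₙ[a+b]∣↧ₙa*↧ₙb a b))
  ... | inj₁ p∣↧a = a∈ℤp p∣↧a
  ... | inj₂ p∣↧b = b∈ℤp p∣↧b

  InZp-* : ∀ a b → InZp p a → InZp p b → InZp p (a * b)
  InZp-* a b a∈ℤp b∈ℤp p∣↧
    with euclidsLemma (↧ₙ a) (↧ₙ b) p-prime (ℕ.∣-trans p∣↧ (↧ₙ[a*b]∣↧ₙa*↧ₙb a b))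
  ... | inj₁ p∣↧a = a∈ℤp p∣↧a
  ... | inj₂ p∣↧b = b∈ℤp p∣↧b

  InZp-neg : ∀ a → InZp p a → InZp p (- a)
  InZp-neg a a∈ℤp p∣↧ = a∈ℤp (subst (p ∣_) (cong ℤ.∣_∣ (ℚ.↧-neg a)) p∣↧)

  InZp-ℕtoℚ : ∀ n → InZp p (ℕtoℚ n)
  InZp-ℕtoℚ n p∣↧ = p∤1 (ℕ.∣-trans p∣↧ (↧ₙ[i/n]∣n (+ n) 1))

  InZp-sgn : ∀ k → InZp p (sgn k)
  InZp-sgn zero    = InZp-ℕtoℚ 1
  InZp-sgn (suc k) = InZp-neg (sgn k) (InZp-sgn k)

  InZp-invFact : ∀ {k} → k < p → InZp p (invFact k)
  InZp-invFact {k} k<p p∣↧ = p∤k! k<p (ℕ.∣-trans p∣↧ (↧ₙ[i/n]∣n (+ 1) (k !) {{k ℕ.!≢0}}))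

  InZp-∑ : ∀ N {f : ℕ → ℚ} → (∀ {t} → t < N → InZp p (f t)) → InZp p (∑ N f)
  InZp-∑ zero    f∈ℤp = InZp-ℕtoℚ 0
  InZp-∑ (suc N) {f} f∈ℤp =
    InZp-+ (f 0) (∑ N (f ∘ suc)) (f∈ℤp (s≤s z≤n)) (InZp-∑ N (λ t<N → f∈ℤp (s≤s t<N)))

  InZp-altStirling : ∀ {N} R n K → N ≤ p → InZp p (altStirling N R n K)
  InZp-altStirling {N} R n K N≤p = InZp-∑ N λ {t} t<N →
    InZp-* (sgn t * invFact t) _
           (InZp-* (sgn t) (invFact t) (InZp-sgn t) (InZp-invFact (ℕ.<-≤-trans t<N N≤p)))
           (InZp-ℕtoℚ (rS (R + t) (n + (R + t)) K))

  InPZp : ℚ → Set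
  InPZp a = Σ ℚ λ c → InZp p c × a ≡ ℕtoℚ p * c

  InPZp-ℕtoℚ : ∀ {n} → p ∣ n → InPZp (ℕtoℚ n)
  InPZp-ℕtoℚ (divides q refl) =
    ℕtoℚ q , InZp-ℕtoℚ q , trans (cong ℕtoℚ (ℕ.*-comm q p)) (ℕtoℚ-* p q)

  InPZp-+ : ∀ {a b} → InPZp a → InPZp b → InPZp (a ℚ.+ b)
  InPZp-+ (c , c∈ℤp , refl) (d , d∈ℤp , refl) =
    c ℚ.+ d , InZp-+ c d c∈ℤp d∈ℤp , sym (ℚ.*-distribˡ-+ (ℕtoℚ p) c d)

  InPZp-neg : ∀ {a} → InPZp a → InPZp (- a)
  InPZp-neg (c , c∈ℤp , refl) = - c , InZp-neg c c∈ℤp , ℚ.neg-distribʳ-* (ℕtoℚ p) c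

  InPZp-*ˡ : ∀ z {a} → InZp p z → InPZp a → InPZp (z * a)
  InPZp-*ˡ z z∈ℤp (c , c∈ℤp , refl) =
    z * c , InZp-* z c z∈ℤp c∈ℤp ,
    solve 3 (λ z p c → z :* (p :* c) := p :* (z :* c)) refl z (ℕtoℚ p) c

  -- CongQ p a b unfolds to InPZp (a - b).
  infix 4 _≈_
  record _≈_ (a b : ℚ) : Set where
    constructor mk≈
    field un≈ : CongQ p a b
  open _≈_ public

  ≈-reflexive : ∀ {a b} → a ≡ b → a ≈ b
  ≈-reflexive {a} refl = mk≈ (subst InPZp (sym (ℚ.+-inverseʳ a)) (InPZp-ℕtoℚ (p ℕ.∣0)))

  ≈-sym : ∀ {a b} → a ≈ b → b ≈ a
  ≈-sym {a} {b} (mk≈ a-b∈pℤp) =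
    mk≈ (subst InPZp (solve 2 (λ a b → :- (a :- b) := b :- a) refl a b) (InPZp-neg a-b∈pℤp))

  ≈-trans : ∀ {a b c} → a ≈ b → b ≈ c → a ≈ c
  ≈-trans {a} {b} {c} (mk≈ a-b∈pℤp) (mk≈ b-c∈pℤp) =
    mk≈ (subst InPZp (solve 3 (λ a b c → (a :- b) :+ (b :- c) := a :- c) refl a b c)
                     (InPZp-+ a-b∈pℤp b-c∈pℤp))

  ≈-setoid : Setoid 0ℓ 0ℓ
  ≈-setoid = record
    { Carrier       = ℚ
    ; _≈_           = _≈_
    ; isEquivalence = record { refl = ≈-reflexive refl ; sym = ≈-sym ; trans = ≈-trans }
    }

  ≈-*-congˡ : ∀ c {a b} → InZp p c → a ≈ b → c * a ≈ c * b
  ≈-*-congˡ c {a} {b} c∈ℤp (mk≈ a-b∈pℤp) =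
    mk≈ (subst InPZp (solve 3 (λ c a b → c :* (a :- b) := c :* a :- c :* b) refl c a b)
                     (InPZp-*ˡ c c∈ℤp a-b∈pℤp))

  ≈-*-congʳ : ∀ c {a b} → InZp p c → a ≈ b → a * c ≈ b * c
  ≈-*-congʳ c {a} {b} c∈ℤp a≈b =
    subst₂ _≈_ (ℚ.*-comm c a) (ℚ.*-comm c b) (≈-*-congˡ c c∈ℤp a≈b)

  ≈-* : ∀ {a b c d} → InZp p a → InZp p d → a ≈ b → c ≈ d → a * c ≈ b * d
  ≈-* {a} {d = d} a∈ℤp d∈ℤp a≈b c≈d =
    ≈-trans (≈-*-congˡ a a∈ℤp c≈d) (≈-*-congʳ d d∈ℤp a≈b)

  InPZp⇒≈0 : ∀ {a} → InPZp a → a ≈ 0ℚ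
  InPZp⇒≈0 {a} a∈pℤp = mk≈ (subst InPZp (sym (ℚ.+-identityʳ a)) a∈pℤp)

  ℕtoℚ[x]≈-ℕtoℚ[y] : ∀ x y → x + y ≡ p → ℕtoℚ x ≈ - ℕtoℚ y
  ℕtoℚ[x]≈-ℕtoℚ[y] x y x+y≡p =
    mk≈ (subst InPZp x+y≡x-[-y] (InPZp-ℕtoℚ (subst (p ∣_) (sym x+y≡p) ℕ.∣-refl)))
    where
    x+y≡x-[-y] : ℕtoℚ (x + y) ≡ ℕtoℚ x - - ℕtoℚ y
    x+y≡x-[-y] =
      trans (ℕtoℚ-+ x y) (solve 2 (λ x y → x :+ y := x :- (:- y)) refl (ℕtoℚ x) (ℕtoℚ y))

  -- i + j = p - 1 is even unless p = 2, and then 1 ≡ -1.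
  sgn-≈ : ∀ i j → suc (i + j) ≡ p → sgn i ≈ sgn j
  sgn-≈ i j 1+i+j≡p with even⊎odd (i + j)
  ... | inj₁ (k , i+j≡k+k)   = ≈-reflexive (sgn-even-sum i j k i+j≡k+k)
  ... | inj₂ (k , i+j≡1+k+k) = sgn-≈-for-p≡2 i j (ℕ.suc-injective (trans 1+i+j≡p p≡2))
    where
    2+k+k≡[1+k]*2 : ∀ k → suc (suc (k + k)) ≡ suc k ℕ.* 2
    2+k+k≡[1+k]*2 = ℕ-Solver.solve-∀
    2∣p : 2 ∣ p
    2∣p = divides (suc k) (trans (sym 1+i+j≡p) (trans (cong suc i+j≡1+k+k) (2+k+k≡[1+k]*2 k)))
    p≡2 : p ≡ 2
    p≡2 with prime⇒irreducible p-prime 2∣p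
    ... | inj₂ 2≡p = sym 2≡p
    sgn-≈-for-p≡2 : ∀ i j → i + j ≡ 1 → sgn i ≈ sgn j
    sgn-≈-for-p≡2 0 1 refl = ℕtoℚ[x]≈-ℕtoℚ[y] 1 1 (sym p≡2)
    sgn-≈-for-p≡2 1 0 refl = ≈-sym (ℕtoℚ[x]≈-ℕtoℚ[y] 1 1 (sym p≡2))

  rising-≈ : ∀ m a j → suc (a + m + j) ≡ p → ℕtoℚ (rising j m) ≈ sgn m * ℕtoℚ (rising a m)
  rising-≈ zero    a j _       = ≈-reflexive (sym (ℚ.*-identityˡ (ℕtoℚ 1)))
  rising-≈ (suc m) a j 1+a+m+j≡p = begin
    ℕtoℚ (rising j m ℕ.* (j + suc m))
      ≡⟨ ℕtoℚ-* (rising j m) (j + suc m) ⟩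
    ℕtoℚ (rising j m) * ℕtoℚ (j + suc m)
      ≈⟨ ≈-* (InZp-ℕtoℚ (rising j m)) (InZp-neg (ℕtoℚ (suc a)) (InZp-ℕtoℚ (suc a)))
             (rising-≈ m (suc a) j (trans (cong (λ x → suc (x + j)) (sym (ℕ.+-suc a m))) 1+a+m+j≡p))
             (ℕtoℚ[x]≈-ℕtoℚ[y] (j + suc m) (suc a) (trans (rearrange j m a) 1+a+m+j≡p)) ⟩
    sgn m * Rₐ₊₁ * - ℕtoℚ (suc a)
      ≡⟨ solve 3 (λ s x y → s :* x :* (:- y) := (:- s) :* (y :* x))
                 refl (sgn m) Rₐ₊₁ (ℕtoℚ (suc a)) ⟩
    sgn (suc m) * (ℕtoℚ (suc a) * Rₐ₊₁)
      ≡⟨ cong (sgn (suc m) *_) (trans (sym (ℕtoℚ-* (suc a) (rising (suc a) m)))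
                                      (cong ℕtoℚ (sym (rising-suc a m)))) ⟩
    sgn (suc m) * ℕtoℚ (rising a (suc m)) ∎
    where
    open import Relation.Binary.Reasoning.Setoid ≈-setoid
    Rₐ₊₁ = ℕtoℚ (rising (suc a) m)
    rearrange : ∀ j m a → j + suc m + suc a ≡ suc (a + suc m + j)
    rearrange = ℕ-Solver.solve-∀

  sgn*rising≈sgn*m!*sgn*C : ∀ m a j → suc (m + a + j) ≡ p →
    sgn (m + a) * ℕtoℚ (rising a m) ≈ sgn m * ℕtoℚ (m !) * (sgn j * ℕtoℚ ((j + m) C m))
  sgn*rising≈sgn*m!*sgn*C m a j 1+m+a+j≡p = begin
    sgn (m + a) * Rₐ
      ≈⟨ ≈-*-congʳ Rₐ (InZp-ℕtoℚ (rising a m)) (sgn-≈ (m + a) j 1+m+a+j≡p) ⟩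
    sgn j * Rₐ
      ≡⟨ cong (sgn j *_) (ℚ.*-identityˡ Rₐ) ⟨
    sgn j * (1ℚ * Rₐ)
      ≡⟨ cong (λ u → sgn j * (u * Rₐ)) (sgn[k]*sgn[k]≡1 m) ⟨
    sgn j * (sgn m * sgn m * Rₐ)
      ≡⟨ solve 3 (λ t s R → t :* (s :* s :* R) := t :* s :* (s :* R)) refl (sgn j) (sgn m) Rₐ ⟩
    sgn j * sgn m * (sgn m * Rₐ)
      ≈⟨ ≈-*-congˡ (sgn j * sgn m) (InZp-* (sgn j) (sgn m) (InZp-sgn j) (InZp-sgn m))
           (≈-sym (rising-≈ m a j (subst (λ x → suc (x + j) ≡ p) (ℕ.+-comm m a) 1+m+a+j≡p))) ⟩
    sgn j * sgn m * ℕtoℚ (rising j m)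
      ≡⟨ cong (sgn j * sgn m *_)
              (trans (sym (ℕtoℚ-* (m !) B)) (cong ℕtoℚ (m!*[j+m]Cm≡rising j m))) ⟨
    sgn j * sgn m * (ℕtoℚ (m !) * ℕtoℚ B)
      ≡⟨ solve 4 (λ t s M C → t :* s :* (M :* C) := s :* M :* (t :* C))
                 refl (sgn j) (sgn m) (ℕtoℚ (m !)) (ℕtoℚ B) ⟩
    sgn m * ℕtoℚ (m !) * (sgn j * ℕtoℚ B) ∎
    where
    open import Relation.Binary.Reasoning.Setoid ≈-setoid
    Rₐ = ℕtoℚ (rising a m)
    B = (j + m) C m

  scaled-altStirling-≈ : ∀ n r m → m < p → ∀ i →
    sgn m * ℕtoℚ (i !) * altStirling (p ∸ m) (r + m) n (i + r)
      ≈ sgn m * ℕtoℚ (m !) * ℕtoℚ ((r + m) ^ n) * polyP (p ∸ 1) m i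
  scaled-altStirling-≈ n r m m<p i with i ≤? p ∸ 1
  ... | no i≰p∸1 = begin
    sgn m * ℕtoℚ (i !) * A
      ≈⟨ ≈-*-congʳ A (InZp-altStirling (r + m) n (i + r) (ℕ.m∸n≤m p m))
           (≈-*-congˡ (sgn m) (InZp-sgn m) (InPZp⇒≈0 (InPZp-ℕtoℚ (p∣n! p≤i)))) ⟩
    sgn m * 0ℚ * A
      ≡⟨ solve 2 (λ s A → s :* con 0ℚ :* A := con 0ℚ) refl (sgn m) A ⟩
    0ℚ
      ≡⟨ ℚ.*-zeroʳ c ⟨
    c * 0ℚ ∎
    where
    open import Relation.Binary.Reasoning.Setoid ≈-setoid
    A = altStirling (p ∸ m) (r + m) n (i + r)
    c = sgn m * ℕtoℚ (m !) * ℕtoℚ ((r + m) ^ n)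
    p≤i : p ≤ i
    p≤i = ℕ.≮⇒≥ (i≰p∸1 ∘ ℕ.<⇒≤pred)
  ... | yes i≤p∸1 with m ≤? i
  ...   | no m≰i = begin
    sgn m * ℕtoℚ (i !) * altStirling (p ∸ m) (r + m) n (i + r)
      ≡⟨ cong (sgn m * ℕtoℚ (i !) *_) (altStirling-< (p ∸ m) (r + m) n (i + r) i+r<r+m) ⟩
    sgn m * ℕtoℚ (i !) * 0ℚ
      ≡⟨ ℚ.*-zeroʳ (sgn m * ℕtoℚ (i !)) ⟩
    0ℚ
      ≡⟨ solve 2 (λ c s → c :* (s :* con 0ℚ) := con 0ℚ) refl c (sgn j) ⟨
    c * (sgn j * 0ℚ)
      ≈⟨ ≈-*-congˡ c c∈ℤp
           (≈-*-congˡ (sgn j) (InZp-sgn j) (InPZp⇒≈0 (InPZp-ℕtoℚ p∣[j+m]Cm))) ⟨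
    c * (sgn j * ℕtoℚ ((j + m) C m)) ∎
    where
    open import Relation.Binary.Reasoning.Setoid ≈-setoid
    c = sgn m * ℕtoℚ (m !) * ℕtoℚ ((r + m) ^ n)
    c∈ℤp : InZp p c
    c∈ℤp = InZp-* (sgn m * ℕtoℚ (m !)) _ (InZp-* (sgn m) _ (InZp-sgn m) (InZp-ℕtoℚ (m !)))
                  (InZp-ℕtoℚ ((r + m) ^ n))
    j = p ∸ 1 ∸ i
    i<m : i < m
    i<m = ℕ.≰⇒> m≰i
    i+r<r+m : i + r < r + m
    i+r<r+m = subst (_< r + m) (ℕ.+-comm r i) (ℕ.+-monoʳ-< r i<m)
    p≤j+m : p ≤ j + m
    p≤j+m = subst (_≤ j + m)
                  (trans (ℕ.+-suc j i) (trans (cong suc (ℕ.m∸n+n≡m i≤p∸1)) 1+[p∸1]≡p))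
                  (ℕ.+-monoʳ-≤ j i<m)
    p∣[j+m]Cm : p ∣ (j + m) C m
    p∣[j+m]Cm = p∣nCk m<p p≤j+m (subst (_< p) (sym (ℕ.m+n∸n≡m j m))
                                       (ℕ.m≤pred[n]⇒suc[m]≤n (ℕ.m∸n≤m (p ∸ 1) i)))
  ...   | yes m≤i with i ∸ m | ℕ.m+[n∸m]≡n m≤i
  ...     | a | refl = begin
    sgn m * ℕtoℚ ((m + a) !) * altStirling (p ∸ m) (r + m) n (m + a + r)
      ≡⟨ scaled-altStirling-value (p ∸ m) n r m a a<p∸m ⟩
    sgn (m + a) * (X * Rₐ)
      ≡⟨ solve 3 (λ s X R → s :* (X :* R) := X :* (s :* R)) refl (sgn (m + a)) X Rₐ ⟩
    X * (sgn (m + a) * Rₐ)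
      ≈⟨ ≈-*-congˡ X (InZp-ℕtoℚ ((r + m) ^ n)) (sgn*rising≈sgn*m!*sgn*C m a j 1+m+a+j≡p) ⟩
    X * (sgn m * ℕtoℚ (m !) * (sgn j * ℕtoℚ B))
      ≡⟨ solve 5 (λ X s M t C → X :* (s :* M :* (t :* C)) := s :* M :* X :* (t :* C))
                 refl X (sgn m) (ℕtoℚ (m !)) (sgn j) (ℕtoℚ B) ⟩
    sgn m * ℕtoℚ (m !) * X * (sgn j * ℕtoℚ B) ∎
    where
    open import Relation.Binary.Reasoning.Setoid ≈-setoid
    X = ℕtoℚ ((r + m) ^ n)
    Rₐ = ℕtoℚ (rising a m)
    j = p ∸ 1 ∸ (m + a)
    B = (j + m) C m
    1+m+a+j≡p : suc (m + a + j) ≡ p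
    1+m+a+j≡p = trans (cong suc (ℕ.m+[n∸m]≡n i≤p∸1)) 1+[p∸1]≡p
    a<p∸m : a < p ∸ m
    a<p∸m = ℕ.m+n≤o⇒m≤o∸n (suc a) (subst (λ x → suc x ≤ p) (ℕ.+-comm m a)
                                          (ℕ.m≤pred[n]⇒suc[m]≤n i≤p∸1))

  polyP[p∸1,0]≈altGeom[p] : ∀ i → polyP (p ∸ 1) 0 i ≈ altGeom p i
  polyP[p∸1,0]≈altGeom[p] i with i ≤? p ∸ 1 | suc i ≤? p
  ... | yes i≤p∸1 | yes _   =
    ≈-trans (≈-reflexive (ℚ.*-identityʳ (sgn (p ∸ 1 ∸ i))))
            (sgn-≈ (p ∸ 1 ∸ i) i (trans (cong suc (ℕ.m∸n+n≡m i≤p∸1)) 1+[p∸1]≡p))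
  ... | no  _     | no  _   = ≈-reflexive refl
  ... | yes i≤p∸1 | no  i≮p = ⊥-elim (i≮p (ℕ.m≤pred[n]⇒suc[m]≤n i≤p∸1))
  ... | no  i≰p∸1 | yes i<p = ⊥-elim (i≰p∸1 (ℕ.<⇒≤pred i<p))

theorem17 : (n r p m : ℕ) → Prime p → m < p →
    CongPoly p
      (sumFromTo m p (λ k → scale (sgn k * invFact (k ∸ m)) (shiftX k (fubini n (r + k) k))))
      (scale (sgn m * ℕtoℚ (m !) * ℕtoℚ ((r + m) ^ n)) (polyP (p ∸ 1) m))
    × CongPoly p
      (sumFromTo 0 p (λ k → scale (sgn k * invFact k) (shiftX k (fubini n (r + k) k))))
      (scale (ℕtoℚ (r ^ n)) (altGeom p))
theorem17 n r p m p-prime m<p = un≈ ∘ fubiniSum-≈ m m<p , un≈ ∘ fubiniSum₀-≈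
  where
  open ModuloPrime p-prime
  open import Relation.Binary.Reasoning.Setoid ≈-setoid

  fubiniSum-≈ : ∀ m → m < p → ∀ i →
    sumFromTo m p (λ k → scale (sgn k * invFact (k ∸ m)) (shiftX k (fubini n (r + k) k))) i
      ≈ sgn m * ℕtoℚ (m !) * ℕtoℚ ((r + m) ^ n) * polyP (p ∸ 1) m i
  fubiniSum-≈ m m<p i = begin
    sumFromTo m p (λ k → scale (sgn k * invFact (k ∸ m)) (shiftX k (fubini n (r + k) k))) i
      ≡⟨ coeff-fubiniSum n r m p i ⟩
    sgn m * ℕtoℚ (i !) * altStirling (p ∸ m) (r + m) n (i + r)
      ≈⟨ scaled-altStirling-≈ n r m m<p i ⟩
    sgn m * ℕtoℚ (m !) * ℕtoℚ ((r + m) ^ n) * polyP (p ∸ 1) m i ∎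

  fubiniSum₀-≈ : ∀ i →
    sumFromTo 0 p (λ k → scale (sgn k * invFact k) (shiftX k (fubini n (r + k) k))) i
      ≈ ℕtoℚ (r ^ n) * altGeom p i
  fubiniSum₀-≈ i = begin
    sumFromTo 0 p (λ k → scale (sgn k * invFact k) (shiftX k (fubini n (r + k) k))) i
      ≈⟨ fubiniSum-≈ 0 (subst (0 <_) 1+[p∸1]≡p (s≤s z≤n)) i ⟩
    1ℚ * ℕtoℚ ((r + 0) ^ n) * polyP (p ∸ 1) 0 i
      ≡⟨ cong (λ x → x * polyP (p ∸ 1) 0 i)
              (trans (ℚ.*-identityˡ _) (cong (λ x → ℕtoℚ (x ^ n)) (ℕ.+-identityʳ r))) ⟩
    ℕtoℚ (r ^ n) * polyP (p ∸ 1) 0 i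
      ≈⟨ ≈-*-congˡ (ℕtoℚ (r ^ n)) (InZp-ℕtoℚ (r ^ n)) (polyP[p∸1,0]≈altGeom[p] i) ⟩
    ℕtoℚ (r ^ n) * altGeom p i ∎
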